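{- Fix a type $\tau$. Let $\mathbf{Lat}^-$ be the category of complete lattices whose morphisms are maps preserving $0$, $1$, finite joins and arbitrary meets, $\mathbf{Rel}_\tau$ the category of relational structures of type $\tau$ with $p$-morphisms, and $\mathbf{Alg}_\tau$ the category of bounded lattices with operations $(g_i)_{i\in I}$ of type $\tau$ and homomorphisms (maps preserving $0,1,\wedge,\vee$ and each $g_i$). The assignment $(L,\mathfrak{X})\mapsto L^{\mathfrak{X}- }$, sending $\phi:L\to M$ to $\alpha\mapsto\phi\circ\alpha$ and a $p$-morphism $p:\mathfrak{X}\to\mathfrak{Y}$ to $\beta\mapsto\beta\circ p$ from $L^{\mathfrak{Y}- }$ to $L^{\mathfrak{X}- }$, is a bifunctor $\mathbf{Lat}^-\times\mathbf{Rel}_\tau\to\mathbf{Alg}_\tau$, covariant in the first argument and contravariant in the second. Moreover: $(\prod_J L_j)^{\mathfrak{X}- }\cong\prod_J L_j^{\mathfrak{X}- }$; $L^{(\bigoplus_J\mathfrak{X}_j)- }\cong\prod_J L^{\mathfrak{X}_j- }$; if $\phi$ is one-one (onto) then so is $\alpha\mapsto\phi\circ\alpha$, and conversely when $X$ is nonempty; and if a $p$-morphism $p$ is one-one (onto) then $\beta\mapsto\beta\circ p$ is onto (one-one).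
   Context: A type is $\tau:I\to\mathbb{N}$, $n_i=\tau(i)$. A relational structure of type $\tau$ is $\mathfrak{X}=(X,(S_i)_{i\in I})$ with $S_i\subseteq X^{n_i+1}$. For a complete lattice $L$, the dual convolution algebra $L^{\mathfrak{X}- }$ is the set $L^X$ of functions $X\to L$ with pointwise $\wedge,\vee,0,1$ and operations $g_i(\alpha_1,\ldots,\alpha_{n_i})(x)=\bigwedge\{\alpha_1(x_1)\vee\cdots\vee\alpha_{n_i}(x_{n_i}):(x_1,\ldots,x_{n_i},x)\in S_i\}$ (empty join is $0$). A $p$-morphism $p:(X,(R_i))\to(Y,(S_i))$ is a function $p:X\to Y$ with $\{(y_1,\ldots,y_{n_i}):(y_1,\ldots,y_{n_i},p(x))\in S_i\}=\{(p(x_1),\ldots,p(x_{n_i})):(x_1,\ldots,x_{n_i},x)\in R_i\}$ for all $i$ and $x$. The disjoint union $\bigoplus_J\mathfrak{X}_j$ has universe the disjoint union of the $X_j$ and $i$-th relation the union of the $i$-th relations. -}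

module Defs where

open import Level using (Level; _⊔_) renaming (suc to lsuc)
open import Data.Nat using (ℕ)
open import Data.Vec using (Vec; []; _∷_; map; zipWith)
open import Data.Vec.Relation.Binary.Pointwise.Inductive using (Pointwise)
open import Data.Product using (Σ; Σ-syntax; ∃; _×_; _,_; proj₁; proj₂)
open import Relation.Binary.Core using (Rel)
open import Relation.Binary.Structures using (IsPartialOrder; IsPreorder; IsEquivalence)
open import Relation.Binary.PropositionalEquality using (_≡_)
open import Algebra.Lattice.Structures using (IsLattice)
import Algebra.Definitions as AD

record Type : Set₁ where
  field
    I  : Set
    ar : I → ℕ
open Type public

record CompleteLattice (c e ℓ : Level) : Set (lsuc (c ⊔ e ⊔ ℓ)) where
  infix 4 _≈_ _≤_
  infixr 6 _∨_
  infixr 7 _∧_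
  field
    Carrier        : Set c
    _≈_            : Rel Carrier e
    _≤_            : Rel Carrier e
    isPartialOrder : IsPartialOrder _≈_ _≤_
    ⋀          : {A : Set ℓ} → (A → Carrier) → Carrier
    ⋀-lower    : {A : Set ℓ} (f : A → Carrier) (a : A) → ⋀ f ≤ f a
    ⋀-greatest : {A : Set ℓ} (f : A → Carrier) (z : Carrier) →
                 ((a : A) → z ≤ f a) → z ≤ ⋀ f
    ⋁          : {A : Set ℓ} → (A → Carrier) → Carrier
    ⋁-upper    : {A : Set ℓ} (f : A → Carrier) (a : A) → f a ≤ ⋁ f
    ⋁-least    : {A : Set ℓ} (f : A → Carrier) (z : Carrier) →
                 ((a : A) → f a ≤ z) → ⋁ f ≤ z
    _∨_        : Carrier → Carrier → Carrier
    ∨-upperˡ   : ∀ x y → x ≤ x ∨ y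
    ∨-upperʳ   : ∀ x y → y ≤ x ∨ y
    ∨-least    : ∀ x y z → x ≤ z → y ≤ z → x ∨ y ≤ z
    _∧_        : Carrier → Carrier → Carrier
    ∧-lowerˡ   : ∀ x y → x ∧ y ≤ x
    ∧-lowerʳ   : ∀ x y → x ∧ y ≤ y
    ∧-greatest : ∀ x y z → z ≤ x → z ≤ y → z ≤ x ∧ y
    ⊥          : Carrier
    ⊥-min      : ∀ x → ⊥ ≤ x
    ⊤          : Carrier
    ⊤-max      : ∀ x → x ≤ ⊤

  joinVec : ∀ {n} → Vec Carrier n → Carrier
  joinVec []       = ⊥
  joinVec (a ∷ as) = a ∨ joinVec as

record LatHom {c₁ e₁ c₂ e₂ ℓ : Level}
              (L : CompleteLattice c₁ e₁ ℓ) (M : CompleteLattice c₂ e₂ ℓ)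
              : Set (c₁ ⊔ e₁ ⊔ c₂ ⊔ e₂ ⊔ lsuc ℓ) where
  private
    module L = CompleteLattice L
    module M = CompleteLattice M
  field
    fun   : L.Carrier → M.Carrier
    cong  : ∀ {x y} → x L.≈ y → fun x M.≈ fun y
    pres⊥ : fun L.⊥ M.≈ M.⊥
    pres⊤ : fun L.⊤ M.≈ M.⊤
    pres∨ : ∀ x y → fun (x L.∨ y) M.≈ (fun x M.∨ fun y)
    pres⋀ : {A : Set ℓ} (f : A → L.Carrier) → fun (L.⋀ f) M.≈ M.⋀ (λ a → fun (f a))

ΠCL : {c e ℓ : Level} (J : Set ℓ) → (J → CompleteLattice c e ℓ) →
      CompleteLattice (ℓ ⊔ c) (ℓ ⊔ e) ℓ
ΠCL J L = record
  { Carrier        = (j : J) → C j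
  ; _≈_            = λ x y → ∀ j → E j (x j) (y j)
  ; _≤_            = λ x y → ∀ j → O j (x j) (y j)
  ; isPartialOrder = record
      { isPreorder = record
          { isEquivalence = record
              { refl  = λ j → IsPartialOrder.Eq.refl (po j)
              ; sym   = λ p j → IsPartialOrder.Eq.sym (po j) (p j)
              ; trans = λ p q j → IsPartialOrder.Eq.trans (po j) (p j) (q j) }
          ; reflexive = λ p j → IsPartialOrder.reflexive (po j) (p j)
          ; trans     = λ p q j → IsPartialOrder.trans (po j) (p j) (q j) }
      ; antisym = λ p q j → IsPartialOrder.antisym (po j) (p j) (q j) }
  ; ⋀          = λ f j → CompleteLattice.⋀ (L j) (λ a → f a j)
  ; ⋀-lower    = λ f a j → CompleteLattice.⋀-lower (L j) (λ a → f a j) a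
  ; ⋀-greatest = λ f z h j → CompleteLattice.⋀-greatest (L j) (λ a → f a j) (z j) (λ a → h a j)
  ; ⋁          = λ f j → CompleteLattice.⋁ (L j) (λ a → f a j)
  ; ⋁-upper    = λ f a j → CompleteLattice.⋁-upper (L j) (λ a → f a j) a
  ; ⋁-least    = λ f z h j → CompleteLattice.⋁-least (L j) (λ a → f a j) (z j) (λ a → h a j)
  ; _∨_        = λ x y j → CompleteLattice._∨_ (L j) (x j) (y j)
  ; ∨-upperˡ   = λ x y j → CompleteLattice.∨-upperˡ (L j) (x j) (y j)
  ; ∨-upperʳ   = λ x y j → CompleteLattice.∨-upperʳ (L j) (x j) (y j)
  ; ∨-least    = λ x y z p q j → CompleteLattice.∨-least (L j) (x j) (y j) (z j) (p j) (q j)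
  ; _∧_        = λ x y j → CompleteLattice._∧_ (L j) (x j) (y j)
  ; ∧-lowerˡ   = λ x y j → CompleteLattice.∧-lowerˡ (L j) (x j) (y j)
  ; ∧-lowerʳ   = λ x y j → CompleteLattice.∧-lowerʳ (L j) (x j) (y j)
  ; ∧-greatest = λ x y z p q j → CompleteLattice.∧-greatest (L j) (x j) (y j) (z j) (p j) (q j)
  ; ⊥          = λ j → CompleteLattice.⊥ (L j)
  ; ⊥-min      = λ x j → CompleteLattice.⊥-min (L j) (x j)
  ; ⊤          = λ j → CompleteLattice.⊤ (L j)
  ; ⊤-max      = λ x j → CompleteLattice.⊤-max (L j) (x j)
  }
  where
  C  = λ j → CompleteLattice.Carrier (L j)
  E  = λ j → CompleteLattice._≈_ (L j)
  O  = λ j → CompleteLattice._≤_ (L j)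
  po = λ j → CompleteLattice.isPartialOrder (L j)

-- Relational structures of type τ.
-- rel i (x₁ ∷ … ∷ xₙ ∷ []) x   means   (x₁,…,xₙ,x) ∈ Sᵢ   (n = ar τ i).

record RelStr (τ : Type) (ℓ : Level) : Set (lsuc ℓ) where
  field
    Carrier : Set ℓ
    rel     : (i : I τ) → Vec Carrier (ar τ i) → Carrier → Set ℓ

IsPMorphism : ∀ {τ ℓ} (X Y : RelStr τ ℓ) → (RelStr.Carrier X → RelStr.Carrier Y) → Set ℓ
IsPMorphism {τ} X Y p =
  (i : I τ) (x : RelStr.Carrier X) (ys : Vec (RelStr.Carrier Y) (ar τ i)) →
    (RelStr.rel Y i ys (p x) →
       Σ[ xs ∈ Vec (RelStr.Carrier X) (ar τ i) ] (RelStr.rel X i xs x × map p xs ≡ ys))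
  × (Σ[ xs ∈ Vec (RelStr.Carrier X) (ar τ i) ] (RelStr.rel X i xs x × map p xs ≡ ys) →
       RelStr.rel Y i ys (p x))

⨁ : ∀ {τ ℓ} (J : Set ℓ) → (J → RelStr τ ℓ) → RelStr τ ℓ
⨁ {τ} J X = record
  { Carrier = Σ J (λ j → RelStr.Carrier (X j))
  ; rel     = λ { i zs (j , x) →
      Σ[ xs ∈ Vec (RelStr.Carrier (X j)) (ar τ i) ]
        (RelStr.rel (X j) i xs x × zs ≡ map (j ,_) xs) }
  }

record AlgStr (τ : Type) (c e : Level) : Set (lsuc (c ⊔ e)) where
  field
    Carrier : Set c
    _≈_     : Rel Carrier e
    _∨_ _∧_ : Carrier → Carrier → Carrier
    ⊥ ⊤     : Carrier
    g       : (i : I τ) → Vec Carrier (ar τ i) → Carrier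

IsAlgτ : ∀ {τ c e} → AlgStr τ c e → Set (c ⊔ e)
IsAlgτ {τ} A =
    IsLattice _≈_ _∨_ _∧_
  × AD.Identity _≈_ ⊥ _∨_
  × AD.Identity _≈_ ⊤ _∧_
  × ((i : I τ) (xs ys : Vec Carrier (ar τ i)) → Pointwise _≈_ xs ys → g i xs ≈ g i ys)
  where open AlgStr A

record IsHom {τ c₁ e₁ c₂ e₂} (A : AlgStr τ c₁ e₁) (B : AlgStr τ c₂ e₂)
             (f : AlgStr.Carrier A → AlgStr.Carrier B) : Set (c₁ ⊔ e₁ ⊔ e₂) where
  private
    module A = AlgStr A
    module B = AlgStr B
  field
    cong  : ∀ {x y} → x A.≈ y → f x B.≈ f y
    pres⊥ : f A.⊥ B.≈ B.⊥
    pres⊤ : f A.⊤ B.≈ B.⊤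
    pres∨ : ∀ x y → f (x A.∨ y) B.≈ (f x B.∨ f y)
    pres∧ : ∀ x y → f (x A.∧ y) B.≈ (f x B.∧ f y)
    presg : ∀ i xs → f (A.g i xs) B.≈ B.g i (map f xs)

record Iso {τ c₁ e₁ c₂ e₂} (A : AlgStr τ c₁ e₁) (B : AlgStr τ c₂ e₂)
           : Set (c₁ ⊔ e₁ ⊔ c₂ ⊔ e₂) where
  field
    to      : AlgStr.Carrier A → AlgStr.Carrier B
    from    : AlgStr.Carrier B → AlgStr.Carrier A
    to-hom   : IsHom A B to
    from-hom : IsHom B A from
    from∘to : ∀ x → AlgStr._≈_ A (from (to x)) x
    to∘from : ∀ y → AlgStr._≈_ B (to (from y)) y

ΠAlg : ∀ {τ c e ℓ} (J : Set ℓ) → (J → AlgStr τ c e) → AlgStr τ (ℓ ⊔ c) (ℓ ⊔ e)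
ΠAlg J A = record
  { Carrier = (j : J) → AlgStr.Carrier (A j)
  ; _≈_     = λ x y → ∀ j → AlgStr._≈_ (A j) (x j) (y j)
  ; _∨_     = λ x y j → AlgStr._∨_ (A j) (x j) (y j)
  ; _∧_     = λ x y j → AlgStr._∧_ (A j) (x j) (y j)
  ; ⊥       = λ j → AlgStr.⊥ (A j)
  ; ⊤       = λ j → AlgStr.⊤ (A j)
  ; g       = λ i xs j → AlgStr.g (A j) i (map (λ x → x j) xs)
  }

conv : ∀ {τ c e ℓ} → CompleteLattice c e ℓ → RelStr τ ℓ → AlgStr τ (ℓ ⊔ c) (ℓ ⊔ e)
conv {τ} L X = record
  { Carrier = X.Carrier → L.Carrier
  ; _≈_     = λ α β → ∀ x → α x L.≈ β x
  ; _∨_     = λ α β x → α x L.∨ β x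
  ; _∧_     = λ α β x → α x L.∧ β x
  ; ⊥       = λ _ → L.⊥
  ; ⊤       = λ _ → L.⊤
  ; g       = λ i αs x →
      L.⋀ {Σ[ xs ∈ Vec X.Carrier (ar τ i) ] X.rel i xs x}
          (λ t → L.joinVec (zipWith (λ α y → α y) αs (proj₁ t)))
  }
  where
  module L = CompleteLattice L
  module X = RelStr X


OneOne : ∀ {a b e₁ e₂} {A : Set a} {B : Set b} → Rel A e₁ → Rel B e₂ → (A → B) → Set (a ⊔ e₁ ⊔ e₂)
OneOne _≈₁_ _≈₂_ f = ∀ {x y} → f x ≈₂ f y → x ≈₁ y

Onto : ∀ {a b e} {A : Set a} {B : Set b} → Rel B e → (A → B) → Set (a ⊔ b ⊔ e)
Onto _≈₂_ f = ∀ y → ∃ λ x → f x ≈₂ y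

φ* : ∀ {a b c} {X : Set a} {L : Set b} {M : Set c} → (L → M) → (X → L) → (X → M)
φ* φ α x = φ (α x)

p* : ∀ {a b c} {X : Set a} {Y : Set b} {L : Set c} → (X → Y) → (Y → L) → (X → L)
p* p β x = β (p x)

-- Everything reduces to one description of the operations: gᵢ(α⃗)(x) is the
-- meet, over the tuples x⃗ with (x⃗, x) ∈ Sᵢ, of the finite joins of α⃗(x⃗).
--   * A complete lattice is an order-theoretic bounded lattice, so its
--     algebraic laws come from the library; they lift pointwise to L^X.
--   * A Lat⁻-morphism φ preserves finite joins and (binary meets being meets
--     of two-element families) binary meets, hence commutes with each gᵢ.
--   * A p-morphism p identifies the tuples related to x with the tuples
--     related to p(x) via map p, so both meets range over the same values.
--   * The projections Π L_j → L_j are Lat⁻-morphisms and the injections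
--     𝔛_j → ⊕ 𝔛_j are p-morphisms; a general characterisation of products of
--     algebras by a jointly injective, jointly surjective family of
--     homomorphisms then yields both product isomorphisms.
-- The functor laws hold definitionally, and the one-one / onto transfers are
-- direct constructions (constant maps for the converses, a meet over the
-- fibre of p for p one-one).
module Submission where

open import Defs
open import Level using (Level; _⊔_; Lift; lift)
open import Data.Bool using (Bool; true; false)
open import Data.Product using (_×_; _,_; proj₁; proj₂; Σ; Σ-syntax)
open import Data.Vec using (Vec; []; _∷_; map; zipWith)
open import Data.Vec.Properties using (map-∘; zipWith-map₁; zipWith-map₂)
open import Data.Vec.Relation.Binary.Pointwise.Inductive using (Pointwise; []; _∷_)
open import Relation.Binary.PropositionalEquality as ≡ using (_≡_; refl)
open import Relation.Binary.Core using (Rel)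
open import Relation.Binary.Structures using (IsPartialOrder)
open import Relation.Binary.Lattice using (BoundedLattice)
import Relation.Binary.Lattice.Properties.Lattice as LatticeProperties
import Relation.Binary.Lattice.Properties.BoundedJoinSemilattice as BoundedJoinProperties
import Relation.Binary.Lattice.Properties.BoundedMeetSemilattice as BoundedMeetProperties
import Relation.Binary.Reasoning.Setoid as SetoidReasoning
open import Algebra.Lattice.Structures using (IsLattice)
import Algebra.Definitions as AD
import Algebra.Construct.Pointwise as PointwiseAlgebra

module CompleteLatticeProperties {c e ℓ : Level} (L : CompleteLattice c e ℓ) where
  open CompleteLattice L public
  open IsPartialOrder isPartialOrder public
    using (antisym; module Eq) renaming (trans to ≤-trans; reflexive to ≤-reflexive)

  boundedLattice : BoundedLattice c e e
  boundedLattice = record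
    { _∨_ = _∨_ ; _∧_ = _∧_ ; ⊤ = ⊤ ; ⊥ = ⊥
    ; isBoundedLattice = record
        { isLattice = record
            { isPartialOrder = isPartialOrder
            ; supremum = λ x y → ∨-upperˡ x y , ∨-upperʳ x y , ∨-least x y
            ; infimum  = λ x y → ∧-lowerˡ x y , ∧-lowerʳ x y , ∧-greatest x y }
        ; maximum = ⊤-max
        ; minimum = ⊥-min } }

  open BoundedLattice boundedLattice public using (setoid)
  module ≈-Reasoning = SetoidReasoning setoid

  isAlgLattice : IsLattice _≈_ _∨_ _∧_
  isAlgLattice = LatticeProperties.isAlgLattice (BoundedLattice.lattice boundedLattice)

  ⊥-identity : AD.Identity _≈_ ⊥ _∨_
  ⊥-identity = BoundedJoinProperties.identity (BoundedLattice.boundedJoinSemilattice boundedLattice)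

  ⊤-identity : AD.Identity _≈_ ⊤ _∧_
  ⊤-identity = BoundedJoinProperties.identity
    (BoundedMeetProperties.dualBoundedJoinSemilattice (BoundedLattice.boundedMeetSemilattice boundedLattice))

  open IsLattice isAlgLattice public using (∨-cong)

  ⋀-sameValues : {A B : Set ℓ} (f : A → Carrier) (g : B → Carrier) →
                 ((a : A) → Σ B (λ b → g b ≈ f a)) → ((b : B) → Σ A (λ a → f a ≈ g b)) →
                 ⋀ f ≈ ⋀ g
  ⋀-sameValues f g f⊆g g⊆f = antisym
    (⋀-greatest g (⋀ f) λ b → let a , fa≈gb = g⊆f b in ≤-trans (⋀-lower f a) (≤-reflexive fa≈gb))
    (⋀-greatest f (⋀ g) λ a → let b , gb≈fa = f⊆g a in ≤-trans (⋀-lower g b) (≤-reflexive gb≈fa))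

  ⋀-cong : {A : Set ℓ} {f g : A → Carrier} → ((a : A) → f a ≈ g a) → ⋀ f ≈ ⋀ g
  ⋀-cong {f = f} {g} f≈g = ⋀-sameValues f g (λ a → a , Eq.sym (f≈g a)) (λ a → a , f≈g a)

  pair : Carrier → Carrier → Lift ℓ Bool → Carrier
  pair x y (lift true)  = x
  pair x y (lift false) = y

  ∧≈⋀pair : ∀ x y → x ∧ y ≈ ⋀ (pair x y)
  ∧≈⋀pair x y = antisym
    (⋀-greatest (pair x y) (x ∧ y) λ { (lift true) → ∧-lowerˡ x y ; (lift false) → ∧-lowerʳ x y })
    (∧-greatest x y _ (⋀-lower (pair x y) (lift true)) (⋀-lower (pair x y) (lift false)))

  joinVec-cong : ∀ {n} {xs ys : Vec Carrier n} → Pointwise _≈_ xs ys → joinVec xs ≈ joinVec ys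
  joinVec-cong []            = Eq.refl
  joinVec-cong (x≈y ∷ xs≈ys) = ∨-cong x≈y (joinVec-cong xs≈ys)

module LatHomProperties {c₁ e₁ c₂ e₂ ℓ : Level} {L : CompleteLattice c₁ e₁ ℓ}
                        {M : CompleteLattice c₂ e₂ ℓ} (φ : LatHom L M) where
  private
    module L = CompleteLatticeProperties L
    module M = CompleteLatticeProperties M
  open LatHom φ

  pres∧ : ∀ x y → fun (x L.∧ y) M.≈ (fun x M.∧ fun y)
  pres∧ x y = begin
    fun (x L.∧ y)                        ≈⟨ cong (L.∧≈⋀pair x y) ⟩
    fun (L.⋀ (L.pair x y))               ≈⟨ pres⋀ (L.pair x y) ⟩
    M.⋀ (λ b → fun (L.pair x y b))       ≈⟨ M.⋀-cong (λ { (lift true)  → M.Eq.refl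
                                                        ; (lift false) → M.Eq.refl }) ⟩
    M.⋀ (M.pair (fun x) (fun y))         ≈⟨ M.Eq.sym (M.∧≈⋀pair (fun x) (fun y)) ⟩
    fun x M.∧ fun y                      ∎
    where open M.≈-Reasoning

  pres-joinVec : ∀ {n} (xs : Vec L.Carrier n) → fun (L.joinVec xs) M.≈ M.joinVec (map fun xs)
  pres-joinVec []       = pres⊥
  pres-joinVec (x ∷ xs) = M.Eq.trans (pres∨ x (L.joinVec xs)) (M.∨-cong M.Eq.refl (pres-joinVec xs))

evalAt : ∀ {a b n} {X : Set a} {C : Set b} → Vec (X → C) n → Vec X n → Vec C n
evalAt αs xs = zipWith (λ α y → α y) αs xs

evalAt-map-points : ∀ {a b c n} {X : Set a} {Y : Set b} {C : Set c}
                    (h : X → Y) (βs : Vec (Y → C) n) (xs : Vec X n) →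
                    evalAt βs (map h xs) ≡ evalAt (map (p* h) βs) xs
evalAt-map-points h βs xs =
  ≡.trans (zipWith-map₂ (λ β y → β y) h βs xs) (≡.sym (zipWith-map₁ (λ α y → α y) (p* h) βs xs))

map-evalAt : ∀ {a b c n} {X : Set a} {C : Set b} {D : Set c}
             (φ : C → D) (αs : Vec (X → C) n) (xs : Vec X n) →
             map φ (evalAt αs xs) ≡ evalAt (map (φ* φ) αs) xs
map-evalAt φ []       []       = refl
map-evalAt φ (α ∷ αs) (x ∷ xs) = ≡.cong (φ (α x) ∷_) (map-evalAt φ αs xs)

RelatedTuples : ∀ {τ ℓ} (X : RelStr τ ℓ) (i : I τ) → RelStr.Carrier X → Set ℓ
RelatedTuples {τ} X i x = Σ[ xs ∈ Vec (RelStr.Carrier X) (ar τ i) ] RelStr.rel X i xs x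

module _ {τ : Type} where

  conv-isAlg : ∀ {c e ℓ} (L : CompleteLattice c e ℓ) (X : RelStr τ ℓ) → IsAlgτ (conv L X)
  conv-isAlg {ℓ = ℓ} L X =
    pointwiseLattice , pointwiseIdentity ⊥ _∨_ ⊥-identity , pointwiseIdentity ⊤ _∧_ ⊤-identity , g-cong
    where
    open CompleteLatticeProperties L
    module L = IsLattice isAlgLattice
    X₀ : Set ℓ
    X₀ = RelStr.Carrier X
    _≐_ : (X₀ → Carrier) → (X₀ → Carrier) → Set _
    α ≐ β = ∀ x → α x ≈ β x

    pointwiseLattice : IsLattice _≐_ (λ α β x → α x ∨ β x) (λ α β x → α x ∧ β x)
    pointwiseLattice = record
      { isEquivalence = PointwiseAlgebra.isEquivalence X₀ L.isEquivalence
      ; ∨-comm  = λ α β x → L.∨-comm (α x) (β x)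
      ; ∨-assoc = λ α β γ x → L.∨-assoc (α x) (β x) (γ x)
      ; ∨-cong  = λ p q x → L.∨-cong (p x) (q x)
      ; ∧-comm  = λ α β x → L.∧-comm (α x) (β x)
      ; ∧-assoc = λ α β γ x → L.∧-assoc (α x) (β x) (γ x)
      ; ∧-cong  = λ p q x → L.∧-cong (p x) (q x)
      ; absorptive = (λ α β x → L.∨-absorbs-∧ (α x) (β x)) , (λ α β x → L.∧-absorbs-∨ (α x) (β x)) }

    pointwiseIdentity : ∀ u _•_ → AD.Identity _≈_ u _•_ →
                        AD.Identity _≐_ (λ _ → u) (λ α β x → α x • β x)
    pointwiseIdentity u _•_ (idˡ , idʳ) = (λ α x → idˡ (α x)) , (λ α x → idʳ (α x))

    evalAt-cong : ∀ {n} {αs βs : Vec (X₀ → Carrier) n} → Pointwise _≐_ αs βs →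
                  (xs : Vec X₀ n) → Pointwise _≈_ (evalAt αs xs) (evalAt βs xs)
    evalAt-cong []             []       = []
    evalAt-cong (α≐β ∷ αs≐βs) (x ∷ xs) = α≐β x ∷ evalAt-cong αs≐βs xs

    g-cong : (i : I τ) (αs βs : Vec (X₀ → Carrier) (ar τ i)) → Pointwise _≐_ αs βs →
             AlgStr.g (conv L X) i αs ≐ AlgStr.g (conv L X) i βs
    g-cong i αs βs αs≐βs x = ⋀-cong λ t → joinVec-cong (evalAt-cong αs≐βs (proj₁ t))

  φ*-hom : ∀ {c₁ e₁ c₂ e₂ ℓ} {L : CompleteLattice c₁ e₁ ℓ} {M : CompleteLattice c₂ e₂ ℓ}
           (φ : LatHom L M) (X : RelStr τ ℓ) → IsHom (conv L X) (conv M X) (φ* (LatHom.fun φ))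
  φ*-hom {L = L} {M} φ X = record
    { cong  = λ α≐β x → φ.cong (α≐β x)
    ; pres⊥ = λ _ → φ.pres⊥
    ; pres⊤ = λ _ → φ.pres⊤
    ; pres∨ = λ α β x → φ.pres∨ (α x) (β x)
    ; pres∧ = λ α β x → pres∧ (α x) (β x)
    ; presg = λ i αs x → M.Eq.trans (φ.pres⋀ _) (M.⋀-cong λ t → joins-commute αs (proj₁ t))
    }
    where
    module φ = LatHom φ
    module L = CompleteLatticeProperties L
    module M = CompleteLatticeProperties M
    open LatHomProperties φ

    joins-commute : ∀ {n} (αs : Vec (RelStr.Carrier X → L.Carrier) n) xs →
                    φ.fun (L.joinVec (evalAt αs xs)) M.≈ M.joinVec (evalAt (map (φ* φ.fun) αs) xs)
    joins-commute αs xs = M.Eq.trans (pres-joinVec (evalAt αs xs))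
                                     (M.Eq.reflexive (≡.cong M.joinVec (map-evalAt φ.fun αs xs)))

  -- Contravariance: a p-morphism p : 𝔛 → 𝔜 induces the homomorphism β ↦ β ∘ p.
  -- The p-morphism condition says that map p sends the tuples related to x
  -- onto the tuples related to p x, so both meets in gᵢ range over the same values.
  p*-hom : ∀ {c e ℓ} (L : CompleteLattice c e ℓ) {X Y : RelStr τ ℓ}
           (p : RelStr.Carrier X → RelStr.Carrier Y) → IsPMorphism X Y p →
           IsHom (conv L Y) (conv L X) (p* p)
  p*-hom {ℓ = ℓ} L {X} {Y} p p-mor = record
    { cong  = λ β≐β' x → β≐β' (p x)
    ; pres⊥ = λ _ → Eq.refl
    ; pres⊤ = λ _ → Eq.refl
    ; pres∨ = λ _ _ _ → Eq.refl
    ; pres∧ = λ _ _ _ → Eq.refl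
    ; presg = λ i βs x → ⋀-sameValues _ _ (back i βs x) (forth i βs x)
    }
    where
    open CompleteLatticeProperties L
    value : ∀ {n} {Z : Set ℓ} → Vec (Z → Carrier) n → Vec Z n → Carrier
    value βs zs = joinVec (evalAt βs zs)

    forth : ∀ i βs x (xs : RelatedTuples X i x) →
            Σ (RelatedTuples Y i (p x)) λ ys → value βs (proj₁ ys) ≈ value (map (p* p) βs) (proj₁ xs)
    forth i βs x (xs , r) =
      (map p xs , proj₂ (p-mor i x (map p xs)) (xs , r , refl)) ,
      Eq.reflexive (≡.cong joinVec (evalAt-map-points p βs xs))

    back : ∀ i βs x (ys : RelatedTuples Y i (p x)) →
           Σ (RelatedTuples X i x) λ xs → value (map (p* p) βs) (proj₁ xs) ≈ value βs (proj₁ ys)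
    back i βs x (ys , r) with proj₁ (p-mor i x ys) r
    ... | xs , r′ , refl =
      (xs , r′) , Eq.reflexive (≡.cong joinVec (≡.sym (evalAt-map-points p βs xs)))

  product-characterisation :
    ∀ {a e₁ b e₂ ℓ} (A : AlgStr τ a e₁) {J : Set ℓ} (B : J → AlgStr τ b e₂) →
    ((j : J) → IsAlgτ (B j)) →
    (h : (j : J) → AlgStr.Carrier A → AlgStr.Carrier (B j)) → ((j : J) → IsHom A (B j) (h j)) →
    (∀ {a a′} → ((j : J) → AlgStr._≈_ (B j) (h j a) (h j a′)) → AlgStr._≈_ A a a′) →
    (realise : AlgStr.Carrier (ΠAlg J B) → AlgStr.Carrier A) →
    (∀ bs j → AlgStr._≈_ (B j) (h j (realise bs)) (bs j)) →
    Iso A (ΠAlg J B)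
  product-characterisation A {J} B B-alg h h-hom jointly-monic realise realises = record
    { to       = to
    ; from     = realise
    ; to-hom   = record
        { cong  = λ a≈a′ j → IsHom.cong (h-hom j) a≈a′
        ; pres⊥ = λ j → IsHom.pres⊥ (h-hom j)
        ; pres⊤ = λ j → IsHom.pres⊤ (h-hom j)
        ; pres∨ = λ a a′ j → IsHom.pres∨ (h-hom j) a a′
        ; pres∧ = λ a a′ j → IsHom.pres∧ (h-hom j) a a′
        ; presg = λ i as j → ≡.subst (λ v → B._≈_ j (h j (A.g i as)) (B.g j i v))
                                     (map-∘ (λ bs → bs j) to as) (IsHom.presg (h-hom j) i as)
        }
    ; from-hom = record
        { cong  = λ bs≈bs′ → jointly-monic λ j → Component.realise-cong j bs≈bs′
        ; pres⊥ = jointly-monic Component.realise-⊥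
        ; pres⊤ = jointly-monic Component.realise-⊤
        ; pres∨ = λ bs bs′ → jointly-monic λ j → Component.realise-∨ j bs bs′
        ; pres∧ = λ bs bs′ → jointly-monic λ j → Component.realise-∧ j bs bs′
        ; presg = λ i bss → jointly-monic λ j → Component.realise-g j i bss
        }
    ; from∘to  = λ a → jointly-monic λ j → realises (to a) j
    ; to∘from  = realises
    }
    where
    module A = AlgStr A
    module B (j : J) = AlgStr (B j)
    module Π = AlgStr (ΠAlg J B)
    to : A.Carrier → Π.Carrier
    to a j = h j a

    module Component (j : J) where
      open AlgStr (B j)
      open IsHom (h-hom j)
      open IsLattice (proj₁ (B-alg j)) using (∨-cong; ∧-cong) renaming (sym to ≈-sym; trans to ≈-trans)
      g-cong : (i : I τ) (xs ys : Vec Carrier (ar τ i)) → Pointwise _≈_ xs ys → g i xs ≈ g i ys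
      g-cong = proj₂ (proj₂ (proj₂ (B-alg j)))

      hr : Π.Carrier → Carrier
      hr bs = h j (realise bs)

      realise-cong : ∀ {bs bs′} → bs Π.≈ bs′ → hr bs ≈ hr bs′
      realise-cong {bs} {bs′} bs≈bs′ = ≈-trans (realises bs j) (≈-trans (bs≈bs′ j) (≈-sym (realises bs′ j)))

      realise-⊥ : hr Π.⊥ ≈ h j A.⊥
      realise-⊥ = ≈-trans (realises Π.⊥ j) (≈-sym pres⊥)

      realise-⊤ : hr Π.⊤ ≈ h j A.⊤
      realise-⊤ = ≈-trans (realises Π.⊤ j) (≈-sym pres⊤)

      realise-∨ : ∀ bs bs′ → hr (bs Π.∨ bs′) ≈ h j (realise bs A.∨ realise bs′)
      realise-∨ bs bs′ = ≈-trans (realises (bs Π.∨ bs′) j)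
        (≈-trans (∨-cong (≈-sym (realises bs j)) (≈-sym (realises bs′ j))) (≈-sym (pres∨ _ _)))

      realise-∧ : ∀ bs bs′ → hr (bs Π.∧ bs′) ≈ h j (realise bs A.∧ realise bs′)
      realise-∧ bs bs′ = ≈-trans (realises (bs Π.∧ bs′) j)
        (≈-trans (∧-cong (≈-sym (realises bs j)) (≈-sym (realises bs′ j))) (≈-sym (pres∧ _ _)))

      components : ∀ {n} (bss : Vec Π.Carrier n) →
                   Pointwise _≈_ (map (λ bs → bs j) bss) (map hr bss)
      components []         = []
      components (bs ∷ bss) = ≈-sym (realises bs j) ∷ components bss

      realise-g : ∀ i bss → hr (Π.g i bss) ≈ h j (A.g i (map realise bss))
      realise-g i bss = ≈-trans (realises (Π.g i bss) j)
        (≈-trans (g-cong i _ _ (components bss))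
        (≈-sym (≡.subst (λ v → h j (A.g i (map realise bss)) ≈ g i v)
                        (≡.sym (map-∘ (h j) realise bss)) (presg i (map realise bss)))))

  projection : ∀ {c e ℓ} {J : Set ℓ} (L : J → CompleteLattice c e ℓ) (j : J) → LatHom (ΠCL J L) (L j)
  projection L j = record
    { fun   = λ a → a j
    ; cong  = λ a≈a′ → a≈a′ j
    ; pres⊥ = Eq.refl
    ; pres⊤ = Eq.refl
    ; pres∨ = λ _ _ → Eq.refl
    ; pres⋀ = λ _ → Eq.refl
    }
    where open CompleteLatticeProperties (L j)

  injection : ∀ {ℓ} {J : Set ℓ} (X : J → RelStr τ ℓ) (j : J) → IsPMorphism (X j) (⨁ J X) (j ,_)
  injection X j i x ys = (λ { (xs , r , eq) → xs , r , ≡.sym eq })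
                       , (λ { (xs , r , eq) → xs , r , ≡.sym eq })

  product-iso : ∀ {c e ℓ} (J : Set ℓ) (L : J → CompleteLattice c e ℓ) (X : RelStr τ ℓ) →
                Iso (conv (ΠCL J L) X) (ΠAlg J (λ j → conv (L j) X))
  product-iso J L X = product-characterisation (conv (ΠCL J L) X) (λ j → conv (L j) X)
    (λ j → conv-isAlg (L j) X)
    (λ j → φ* (LatHom.fun (projection L j))) (λ j → φ*-hom (projection L j) X)
    (λ α≐α′ x j → α≐α′ j x)
    (λ βs x j → βs j x) (λ βs j x → CompleteLatticeProperties.Eq.refl (L j))

  sum-iso : ∀ {c e ℓ} (L : CompleteLattice c e ℓ) (J : Set ℓ) (X : J → RelStr τ ℓ) →
            Iso (conv L (⨁ J X)) (ΠAlg J (λ j → conv L (X j)))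
  sum-iso L J X = product-characterisation (conv L (⨁ J X)) (λ j → conv L (X j))
    (λ j → conv-isAlg L (X j))
    (λ j → p* (j ,_)) (λ j → p*-hom L (j ,_) (injection X j))
    (λ α≐α′ → λ { (j , x) → α≐α′ j x })
    (λ βs z → βs (proj₁ z) (proj₂ z)) (λ βs j x → CompleteLatticeProperties.Eq.refl L)

-- One-one and onto transfer along the covariant action; the converses use
-- constant valuations at a point of the nonempty carrier.
module _ {a c₁ c₂ : Level} {X : Set a} {L : Set c₁} {M : Set c₂} (φ : L → M) where
  private
    Pointwise≈ : ∀ {b e} {C : Set b} → (C → C → Set e) → (X → C) → (X → C) → Set (a ⊔ e)
    Pointwise≈ _≈_ α β = ∀ x → α x ≈ β x

  φ*-oneOne : ∀ {e₁ e₂} (_≈L_ : Rel L e₁) (_≈M_ : Rel M e₂) →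
              OneOne _≈L_ _≈M_ φ → OneOne (Pointwise≈ _≈L_) (Pointwise≈ _≈M_) (φ* φ)
  φ*-oneOne _ _ φ-inj φα≐φβ x = φ-inj (φα≐φβ x)

  φ*-onto : ∀ {e} (_≈M_ : Rel M e) → Onto _≈M_ φ → Onto (Pointwise≈ _≈M_) (φ* φ)
  φ*-onto _ φ-onto α = (λ x → proj₁ (φ-onto (α x))) , λ x → proj₂ (φ-onto (α x))

  oneOne-from-φ* : ∀ {e₁ e₂} (_≈L_ : Rel L e₁) (_≈M_ : Rel M e₂) → X →
                   OneOne (Pointwise≈ _≈L_) (Pointwise≈ _≈M_) (φ* φ) → OneOne _≈L_ _≈M_ φ
  oneOne-from-φ* _ _ x₀ φ*-inj {u} {v} φu≈φv = φ*-inj {λ _ → u} {λ _ → v} (λ _ → φu≈φv) x₀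

  onto-from-φ* : ∀ {e} (_≈M_ : Rel M e) → X → Onto (Pointwise≈ _≈M_) (φ* φ) → Onto _≈M_ φ
  onto-from-φ* _ x₀ φ*-onto m = let α , φα≐m = φ*-onto (λ _ → m) in α x₀ , φα≐m x₀

module _ {c e ℓ : Level} (L : CompleteLattice c e ℓ) {X Y : Set ℓ} (p : X → Y) where
  open CompleteLatticeProperties L

  -- If p is one-one, α is the restriction along p of y ↦ ⋀ {α x | p x = y}.
  p*-onto : OneOne _≡_ _≡_ p → Onto (λ α β → ∀ x → α x ≈ β x) (p* {L = Carrier} p)
  p*-onto p-inj α = extend , λ x → antisym (⋀-lower _ (x , refl)) (⋀-greatest _ _ (fibre-value x))
    where
    extend : Y → Carrier
    extend y = ⋀ {Σ X λ x → p x ≡ y} (λ t → α (proj₁ t))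
    fibre-value : ∀ x (t : Σ X λ x′ → p x′ ≡ p x) → α x ≤ α (proj₁ t)
    fibre-value x (x′ , px′≡px) = ≤-reflexive (Eq.reflexive (≡.cong α (p-inj (≡.sym px′≡px))))

  -- If p is onto, every point of Y is some p x, where β ∘ p determines β.
  p*-oneOne : Onto _≡_ p → OneOne (λ β β′ → ∀ y → β y ≈ β′ y) (λ α α′ → ∀ x → α x ≈ α′ x) (p* {L = Carrier} p)
  p*-oneOne p-onto {β} {β′} βp≐β′p y with p-onto y
  ... | x , refl = βp≐β′p x

theorem5p5 : ∀ {c e ℓ : Level} (τ : Type) →
      ((L : CompleteLattice c e ℓ) (X : RelStr τ ℓ) → IsAlgτ (conv L X))
    × ((L M : CompleteLattice c e ℓ) (φ : LatHom L M) (X : RelStr τ ℓ) →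
         IsHom (conv L X) (conv M X) (φ* (LatHom.fun φ)))
    × ((L : CompleteLattice c e ℓ) (X Y : RelStr τ ℓ)
       (p : RelStr.Carrier X → RelStr.Carrier Y) → IsPMorphism X Y p →
         IsHom (conv L Y) (conv L X) (p* p))
    × ((L : CompleteLattice c e ℓ) (X : RelStr τ ℓ) (α : AlgStr.Carrier (conv L X)) →
         AlgStr._≈_ (conv L X) (φ* (λ a → a) α) α)
    × ((L M N : CompleteLattice c e ℓ) (φ : LatHom L M) (ψ : LatHom M N) (X : RelStr τ ℓ)
       (α : AlgStr.Carrier (conv L X)) →
         AlgStr._≈_ (conv N X) (φ* (λ a → LatHom.fun ψ (LatHom.fun φ a)) α)
                               (φ* (LatHom.fun ψ) (φ* (LatHom.fun φ) α)))
    × ((L : CompleteLattice c e ℓ) (X : RelStr τ ℓ) (β : AlgStr.Carrier (conv L X)) →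
         AlgStr._≈_ (conv L X) (p* (λ x → x) β) β)
    × ((L : CompleteLattice c e ℓ) (X Y Z : RelStr τ ℓ)
       (p : RelStr.Carrier X → RelStr.Carrier Y) (q : RelStr.Carrier Y → RelStr.Carrier Z) →
       IsPMorphism X Y p → IsPMorphism Y Z q → (β : AlgStr.Carrier (conv L Z)) →
         AlgStr._≈_ (conv L X) (p* (λ x → q (p x)) β) (p* p (p* q β)))
    × ((L M : CompleteLattice c e ℓ) (φ : LatHom L M) (X Y : RelStr τ ℓ)
       (p : RelStr.Carrier X → RelStr.Carrier Y) → IsPMorphism X Y p →
       (β : AlgStr.Carrier (conv L Y)) →
         AlgStr._≈_ (conv M X) (φ* (LatHom.fun φ) (p* p β)) (p* p (φ* (LatHom.fun φ) β)))
    × ((J : Set ℓ) (L : J → CompleteLattice c e ℓ) (X : RelStr τ ℓ) →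
         Iso (conv (ΠCL J L) X) (ΠAlg J (λ j → conv (L j) X)))
    × ((L : CompleteLattice c e ℓ) (J : Set ℓ) (X : J → RelStr τ ℓ) →
         Iso (conv L (⨁ J X)) (ΠAlg J (λ j → conv L (X j))))
    × ((L M : CompleteLattice c e ℓ) (φ : LatHom L M) (X : RelStr τ ℓ) →
         OneOne (CompleteLattice._≈_ L) (CompleteLattice._≈_ M) (LatHom.fun φ) →
         OneOne (AlgStr._≈_ (conv L X)) (AlgStr._≈_ (conv M X)) (φ* (LatHom.fun φ)))
    × ((L M : CompleteLattice c e ℓ) (φ : LatHom L M) (X : RelStr τ ℓ) →
         Onto (CompleteLattice._≈_ M) (LatHom.fun φ) →
         Onto (AlgStr._≈_ (conv M X)) (φ* (LatHom.fun φ)))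
    × ((L M : CompleteLattice c e ℓ) (φ : LatHom L M) (X : RelStr τ ℓ) →
         RelStr.Carrier X →
         OneOne (AlgStr._≈_ (conv L X)) (AlgStr._≈_ (conv M X)) (φ* (LatHom.fun φ)) →
         OneOne (CompleteLattice._≈_ L) (CompleteLattice._≈_ M) (LatHom.fun φ))
    × ((L M : CompleteLattice c e ℓ) (φ : LatHom L M) (X : RelStr τ ℓ) →
         RelStr.Carrier X →
         Onto (AlgStr._≈_ (conv M X)) (φ* (LatHom.fun φ)) →
         Onto (CompleteLattice._≈_ M) (LatHom.fun φ))
    × ((L : CompleteLattice c e ℓ) (X Y : RelStr τ ℓ)
       (p : RelStr.Carrier X → RelStr.Carrier Y) → IsPMorphism X Y p →
         OneOne _≡_ _≡_ p → Onto (AlgStr._≈_ (conv L X)) (p* p))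
    × ((L : CompleteLattice c e ℓ) (X Y : RelStr τ ℓ)
       (p : RelStr.Carrier X → RelStr.Carrier Y) → IsPMorphism X Y p →
         Onto _≡_ p → OneOne (AlgStr._≈_ (conv L Y)) (AlgStr._≈_ (conv L X)) (p* p))
theorem5p5 τ =
    conv-isAlg
  , (λ L M φ X → φ*-hom φ X)
  , (λ L X Y p → p*-hom L p)
  , (λ L X α x → refl≈ L)
  , (λ L M N φ ψ X α x → refl≈ N)
  , (λ L X β x → refl≈ L)
  , (λ L X Y Z p q _ _ β x → refl≈ L)
  , (λ L M φ X Y p _ β x → refl≈ M)
  , product-iso
  , sum-iso
  , (λ L M φ X → φ*-oneOne (LatHom.fun φ) (CompleteLattice._≈_ L) (CompleteLattice._≈_ M))
  , (λ L M φ X → φ*-onto (LatHom.fun φ) (CompleteLattice._≈_ M))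
  , (λ L M φ X → oneOne-from-φ* (LatHom.fun φ) (CompleteLattice._≈_ L) (CompleteLattice._≈_ M))
  , (λ L M φ X → onto-from-φ* (LatHom.fun φ) (CompleteLattice._≈_ M))
  , (λ L X Y p _ → p*-onto L p)
  , (λ L X Y p _ → p*-oneOne L p)
  where
  refl≈ : ∀ {c e ℓ} (L : CompleteLattice c e ℓ) {x : CompleteLattice.Carrier L} → CompleteLattice._≈_ L x x
  refl≈ L = CompleteLatticeProperties.Eq.refl L
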